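{- Let $k$ be a natural number. Suppose that $\psi$ is obtained from a formula $\varphi$ by replacing an occurrence of a subformula $\xi$ of $\varphi$ with a formula $\delta$ such that $\xi \rhd \delta$. (1) If $\psi \in \mathrm{E}_k^+$, then $\varphi \in \mathrm{E}_k^+$. (2) If $\psi \in \mathrm{U}_k^+$, then $\varphi \in \mathrm{U}_k^+$.
   Context: Fix an arbitrary first-order language whose logical symbols are $\forall, \exists, \to, \land, \lor, \perp$; $\mathrm{FV}(\varphi)$ is the set of free variables of $\varphi$. Alternation paths: finite sequences of $+$ and $-$ in which $+$ and $-$ alternate. For such $s$, $i(s)$ is its first symbol if $s$ is nonempty and a special symbol $\times$ if $s=\langle\,\rangle$; $s^\perp$ swaps $+$ and $-$; $l(s)$ is its length; $+s$, $-s$ denote prepending. $\mathrm{Alt}(\varphi)$: if $\varphi$ is quantifier-free, $\{\langle\,\rangle\}$; otherwise $\mathrm{Alt}(\varphi_1 \land \varphi_2)=\mathrm{Alt}(\varphi_1 \lor \varphi_2) = \mathrm{Alt}(\varphi_1)\cup\mathrm{Alt}(\varphi_2)$; $\mathrm{Alt}(\varphi_1\to\varphi_2) = \{s^\perp : s\in\mathrm{Alt}(\varphi_1)\}\cup\mathrm{Alt}(\varphi_2)$; $\mathrm{Alt}(\forall x\varphi_1) = \{s\in\mathrm{Alt}(\varphi_1): i(s)=-\}\cup\{ -s: s\in\mathrm{Alt}(\varphi_1), i(s)\neq -\}$; $\mathrm{Alt}(\exists x\varphi_1) = \{s\in\mathrm{Alt}(\varphi_1): i(s)=+\}\cup\{+s: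 s\in\mathrm{Alt}(\varphi_1), i(s)\neq +\}$. $\deg(\varphi)=\max\{l(s): s\in\mathrm{Alt}(\varphi)\}$. Classes: $\mathrm{F}_k=\{\varphi:\deg(\varphi)=k\}$; $\mathrm{U}_0=\mathrm{E}_0=\mathrm{F}_0$; $\mathrm{U}_{k+1}=\{\varphi\in\mathrm{F}_{k+1}: i(s)=- \text{ for all } s\in\mathrm{Alt}(\varphi) \text{ with } l(s)=k+1\}$; $\mathrm{E}_{k+1}$ likewise with $+$; $\mathrm{U}_k^+=\mathrm{U}_k\cup\bigcup_{i<k}\mathrm{F}_i$; $\mathrm{E}_k^+=\mathrm{E}_k\cup\bigcup_{i<k}\mathrm{F}_i$. Prenex transformation: $\varphi\rhd\psi$ means that for some formulas $\xi,\delta$, a variable $x\notin\mathrm{FV}(\delta)$, a variable $y$ not occurring in $\xi$, and $Q\in\{\forall,\exists\}$, $(\varphi,\psi)$ is one of: $(\exists x\xi(x)\to\delta, \forall x(\xi(x)\to\delta))$; $(\forall x\xi(x)\to\delta, \exists x(\xi(x)\to\delta))$; $(\delta\to Qx\,\xi(x), Qx(\delta\to\xi(x)))$; $(Qx\,\xi(x)\land\delta, Qx(\xi(x)\land\delta))$; $(\delta\land Qx\,\xi(x), Qx(\delta\land\xi(x)))$; $(Qx\,\xi(x)\lor\delta, Qx(\xi(x)\lor\delta))$; $(\delta\lor Qx\,\xi(x), Qx(\delta\lor\xi(x)))$; $(Qx\,\xi(x), Qy\,\xi(y))$, with $\xi(y)$ the substitution of $y$ for free $x$. -}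

module Defs where

open import Data.Nat using (ℕ; zero; suc; _<_; _⊔_)
open import Data.Nat.Properties using (_≟_)
open import Data.Fin using (Fin)
open import Data.Bool using (Bool; true; false; _∧_; if_then_else_)
open import Data.List using (List; []; _∷_; _++_; map; concatMap; length; foldr)
open import Data.List.Membership.Propositional using (_∈_)
open import Data.Maybe using (Maybe; just; nothing)
open import Data.Product using (Σ; _×_; ∃)
open import Data.Sum using (_⊎_)
open import Relation.Binary.PropositionalEquality using (_≡_)
open import Relation.Nullary using (¬_; yes; no)

record Language : Set₁ where
  field
    Func   : Set
    Pred   : Set
    farity : Func → ℕ
    parity : Pred → ℕ

Var : Set
Var = ℕ

data Quant : Set where
  ∀q ∃q : Quant

data Sign : Set where
  plus minus : Sign

Path : Set
Path = List Sign

flipS : Sign → Sign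
flipS plus  = minus
flipS minus = plus

_⊥ₚ : Path → Path
s ⊥ₚ = map flipS s

-- i(s): first symbol, or nothing (= ×) for the empty path
i : Path → Maybe Sign
i []      = nothing
i (a ∷ _) = just a

startsWith : Sign → Path → Bool
startsWith plus  (plus ∷ _)  = true
startsWith minus (minus ∷ _) = true
startsWith _     _           = false

module _ (L : Language) where
  open Language L

  data Term : Set where
    var : Var → Term
    fun : (f : Func) → (Fin (farity f) → Term) → Term

  data Formula : Set where
    atom : (p : Pred) → (Fin (parity p) → Term) → Formula
    bot  : Formula
    _⇒_ _∧ᶠ_ _∨ᶠ_ : Formula → Formula → Formula
    all ex : Var → Formula → Formula

  quant : Quant → Var → Formula → Formula
  quant ∀q x φ = all x φ
  quant ∃q x φ = ex x φ

  data OccT (y : Var) : Term → Set where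
    here : OccT y (var y)
    arg  : ∀ {f ts} (j : Fin (farity f)) → OccT y (ts j) → OccT y (fun f ts)

  data _∈FV_ (x : Var) : Formula → Set where
    atomFV : ∀ {p ts} (j : Fin (parity p)) → OccT x (ts j) → x ∈FV atom p ts
    ⇒l : ∀ {a b} → x ∈FV a → x ∈FV (a ⇒ b)
    ⇒r : ∀ {a b} → x ∈FV b → x ∈FV (a ⇒ b)
    ∧l : ∀ {a b} → x ∈FV a → x ∈FV (a ∧ᶠ b)
    ∧r : ∀ {a b} → x ∈FV b → x ∈FV (a ∧ᶠ b)
    ∨l : ∀ {a b} → x ∈FV a → x ∈FV (a ∨ᶠ b)
    ∨r : ∀ {a b} → x ∈FV b → x ∈FV (a ∨ᶠ b)
    allFV : ∀ {y a} → ¬ (x ≡ y) → x ∈FV a → x ∈FV all y a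
    exFV  : ∀ {y a} → ¬ (x ≡ y) → x ∈FV a → x ∈FV ex y a

  data Occurs (x : Var) : Formula → Set where
    atomO : ∀ {p ts} (j : Fin (parity p)) → OccT x (ts j) → Occurs x (atom p ts)
    ⇒l : ∀ {a b} → Occurs x a → Occurs x (a ⇒ b)
    ⇒r : ∀ {a b} → Occurs x b → Occurs x (a ⇒ b)
    ∧l : ∀ {a b} → Occurs x a → Occurs x (a ∧ᶠ b)
    ∧r : ∀ {a b} → Occurs x b → Occurs x (a ∧ᶠ b)
    ∨l : ∀ {a b} → Occurs x a → Occurs x (a ∨ᶠ b)
    ∨r : ∀ {a b} → Occurs x b → Occurs x (a ∨ᶠ b)
    allV : ∀ {a} → Occurs x (all x a)
    exV  : ∀ {a} → Occurs x (ex x a)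
    allB : ∀ {y a} → Occurs x a → Occurs x (all y a)
    exB  : ∀ {y a} → Occurs x a → Occurs x (ex y a)

  substT : Var → Var → Term → Term
  substT x y (var z) with z ≟ x
  ... | yes _ = var y
  ... | no  _ = var z
  substT x y (fun f ts) = fun f (λ j → substT x y (ts j))

  substF : Var → Var → Formula → Formula
  substF x y (atom p ts) = atom p (λ j → substT x y (ts j))
  substF x y bot = bot
  substF x y (a ⇒ b) = substF x y a ⇒ substF x y b
  substF x y (a ∧ᶠ b) = substF x y a ∧ᶠ substF x y b
  substF x y (a ∨ᶠ b) = substF x y a ∨ᶠ substF x y b
  substF x y (all z a) with z ≟ x
  ... | yes _ = all z a
  ... | no  _ = all z (substF x y a)
  substF x y (ex z a) with z ≟ x
  ... | yes _ = ex z a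
  ... | no  _ = ex z (substF x y a)

  isQF : Formula → Bool
  isQF (atom _ _) = true
  isQF bot = true
  isQF (a ⇒ b) = isQF a ∧ isQF b
  isQF (a ∧ᶠ b) = isQF a ∧ isQF b
  isQF (a ∨ᶠ b) = isQF a ∧ isQF b
  isQF (all _ _) = false
  isQF (ex _ _) = false

  prefixUnless : Sign → Path → Path
  prefixUnless σ s = if startsWith σ s then s else σ ∷ s

  -- Alt(φ), the (finite) set of alternation paths, as a list
  Alt : Formula → List Path
  Alt (atom _ _) = [] ∷ []
  Alt bot = [] ∷ []
  Alt (a ⇒ b) = if isQF (a ⇒ b) then [] ∷ [] else map _⊥ₚ (Alt a) ++ Alt b
  Alt (a ∧ᶠ b) = if isQF (a ∧ᶠ b) then [] ∷ [] else Alt a ++ Alt b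
  Alt (a ∨ᶠ b) = if isQF (a ∨ᶠ b) then [] ∷ [] else Alt a ++ Alt b
  Alt (all _ a) = map (prefixUnless minus) (Alt a)
  Alt (ex _ a) = map (prefixUnless plus) (Alt a)

  deg : Formula → ℕ
  deg φ = foldr _⊔_ 0 (map length (Alt φ))

  F : ℕ → Formula → Set
  F k φ = deg φ ≡ k

  U : ℕ → Formula → Set
  U zero φ = F zero φ
  U (suc k) φ = F (suc k) φ × (∀ s → s ∈ Alt φ → length s ≡ suc k → i s ≡ just minus)

  E : ℕ → Formula → Set
  E zero φ = F zero φ
  E (suc k) φ = F (suc k) φ × (∀ s → s ∈ Alt φ → length s ≡ suc k → i s ≡ just plus)

  U⁺ : ℕ → Formula → Set
  U⁺ k φ = U k φ ⊎ (Σ ℕ λ j → j < k × F j φ)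

  E⁺ : ℕ → Formula → Set
  E⁺ k φ = E k φ ⊎ (Σ ℕ λ j → j < k × F j φ)

  data _▷_ : Formula → Formula → Set where
    ex⇒  : ∀ x ξ δ → ¬ (x ∈FV δ) → (ex x ξ ⇒ δ) ▷ all x (ξ ⇒ δ)
    all⇒ : ∀ x ξ δ → ¬ (x ∈FV δ) → (all x ξ ⇒ δ) ▷ ex x (ξ ⇒ δ)
    ⇒Q   : ∀ Q x ξ δ → ¬ (x ∈FV δ) → (δ ⇒ quant Q x ξ) ▷ quant Q x (δ ⇒ ξ)
    Q∧   : ∀ Q x ξ δ → ¬ (x ∈FV δ) → (quant Q x ξ ∧ᶠ δ) ▷ quant Q x (ξ ∧ᶠ δ)
    ∧Q   : ∀ Q x ξ δ → ¬ (x ∈FV δ) → (δ ∧ᶠ quant Q x ξ) ▷ quant Q x (δ ∧ᶠ ξ)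
    Q∨   : ∀ Q x ξ δ → ¬ (x ∈FV δ) → (quant Q x ξ ∨ᶠ δ) ▷ quant Q x (ξ ∨ᶠ δ)
    ∨Q   : ∀ Q x ξ δ → ¬ (x ∈FV δ) → (δ ∨ᶠ quant Q x ξ) ▷ quant Q x (δ ∨ᶠ ξ)
    rename : ∀ Q x y ξ → ¬ Occurs y ξ → quant Q x ξ ▷ quant Q y (substF x y ξ)

  data Replace : Formula → Formula → Set where
    here : ∀ {ξ δ} → ξ ▷ δ → Replace ξ δ
    ⇒l : ∀ {a a′ b} → Replace a a′ → Replace (a ⇒ b) (a′ ⇒ b)
    ⇒r : ∀ {a b b′} → Replace b b′ → Replace (a ⇒ b) (a ⇒ b′)
    ∧l : ∀ {a a′ b} → Replace a a′ → Replace (a ∧ᶠ b) (a′ ∧ᶠ b)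
    ∧r : ∀ {a b b′} → Replace b b′ → Replace (a ∧ᶠ b) (a ∧ᶠ b′)
    ∨l : ∀ {a a′ b} → Replace a a′ → Replace (a ∨ᶠ b) (a′ ∨ᶠ b)
    ∨r : ∀ {a b b′} → Replace b b′ → Replace (a ∨ᶠ b) (a ∨ᶠ b′)
    allR : ∀ {x a a′} → Replace a a′ → Replace (all x a) (all x a′)
    exR  : ∀ {x a a′} → Replace a a′ → Replace (ex x a) (ex x a′)

-- Say a path s is dominated by t when t is longer, or as long and with the same first
-- symbol, and a set of paths by another when each member is dominated by some member of the
-- other. Degree and E/U-membership only depend on the longest paths and their first symbols,
-- so if Alt φ is dominated by Alt ψ, then φ lies in E⁺ₖ (U⁺ₖ) whenever ψ does. Domination is
-- preserved by the operations from which Alt is built (union, s ↦ s⊥, prefixing the sign of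
-- a quantifier), and a prenex step only prepends a sign to some of the paths, so replacing
-- a subformula ξ by δ with ξ ▷ δ produces a formula whose paths dominate the old ones.
module Submission where

open import Defs
open import Data.Nat using (ℕ; zero; suc; _≤_; _<_; _⊔_; s≤s; z≤n)
open import Data.Nat.Properties
  using (≤-refl; ≤-reflexive; ≤-trans; ≤-antisym; ≤∧≢⇒<; m≤n⇒m≤1+n; n≤1+n; 1+n≢n;
         m≤m⊔n; m≤n⊔m; ⊔-lub; m≤n⇒m<n∨m≡n; ≤-<-trans; _≟_)
open import Data.Bool using (Bool; true; false; _∧_; if_then_else_)
open import Data.List using (List; []; _∷_; _++_; map; length; foldr)
open import Data.List.Properties using (length-map; map-++; map-∘; map-cong)
open import Data.List.Membership.Propositional using (_∈_)
open import Data.List.Membership.Propositional.Properties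
  using (∈-map⁺; ∈-map⁻; ∈-++⁺ˡ; ∈-++⁺ʳ; ∈-++⁻)
open import Data.List.Relation.Unary.Any using (here; there)
open import Data.List.Relation.Binary.BagAndSetEquality
  using (_∼[_]_; set; [_]-Equality; ++-cong; ++-idempotent)
  renaming (map-cong to map-cong-∼)
open import Data.Maybe using (just)
import Data.Maybe as Maybe
open import Data.Product using (_×_; _,_; Σ; ∃-syntax)
open import Data.Sum using (_⊎_; inj₁; inj₂; [_,_])
open import Function using (_∘_; Equivalence)
open import Relation.Binary.Bundles using (Setoid)
open import Relation.Binary.PropositionalEquality
  using (_≡_; refl; sym; trans; cong; cong₂; subst₂; module ≡-Reasoning)
open import Relation.Nullary using (yes; no; contradiction)

private
  module SetEq = Setoid ([ set ]-Equality Path)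

open Equivalence using (to; from)

infix 4 _≼_ _⊑_

_≼_ : Path → Path → Set
s ≼ t = length s ≤ length t × (length s ≡ length t → i s ≡ i t)

≼-refl : ∀ {s} → s ≼ s
≼-refl = ≤-refl , λ _ → refl

i-⊥ₚ : ∀ s → i (s ⊥ₚ) ≡ Maybe.map flipS (i s)
i-⊥ₚ []      = refl
i-⊥ₚ (_ ∷ _) = refl

⊥ₚ-mono-≼ : ∀ {s t} → s ≼ t → s ⊥ₚ ≼ t ⊥ₚ
⊥ₚ-mono-≼ {s} {t} (|s|≤|t| , same-i) =
  subst₂ _≤_ (sym (length-map flipS s)) (sym (length-map flipS t)) |s|≤|t| ,
  λ eq → begin
    i (s ⊥ₚ)                 ≡⟨ i-⊥ₚ s ⟩
    Maybe.map flipS (i s)    ≡⟨ cong (Maybe.map flipS) (same-i (trans (sym (length-map flipS s))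
                                                              (trans eq (length-map flipS t)))) ⟩
    Maybe.map flipS (i t)    ≡⟨ i-⊥ₚ t ⟨
    i (t ⊥ₚ)                 ∎
  where open ≡-Reasoning

startsWith-cong : ∀ σ {s t} → i s ≡ i t → startsWith σ s ≡ startsWith σ t
startsWith-cong σ     {[]}        {[]}    _    = refl
startsWith-cong σ     {[]}        {_ ∷ _} ()
startsWith-cong σ     {_ ∷ _}     {[]}    ()
startsWith-cong plus  {plus ∷ _}  {_ ∷ _} refl = refl
startsWith-cong plus  {minus ∷ _} {_ ∷ _} refl = refl
startsWith-cong minus {plus ∷ _}  {_ ∷ _} refl = refl
startsWith-cong minus {minus ∷ _} {_ ∷ _} refl = refl

_⊑_ : List Path → List Path → Set
xs ⊑ ys = ∀ {s} → s ∈ xs → ∃[ t ] t ∈ ys × s ≼ t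

⊑-refl : ∀ {xs} → xs ⊑ xs
⊑-refl s∈xs = _ , s∈xs , ≼-refl

⊑-respects-∼ : ∀ {xs xs′ ys ys′} → xs ∼[ set ] xs′ → ys ∼[ set ] ys′ → xs′ ⊑ ys′ → xs ⊑ ys
⊑-respects-∼ xs∼xs′ ys∼ys′ xs′⊑ys′ s∈xs with xs′⊑ys′ (to xs∼xs′ s∈xs)
... | t , t∈ys′ , s≼t = t , from ys∼ys′ t∈ys′ , s≼t

++⁺-⊑ : ∀ {xs xs′ ys ys′} → xs ⊑ xs′ → ys ⊑ ys′ → xs ++ ys ⊑ xs′ ++ ys′
++⁺-⊑ {xs} {xs′} xs⊑xs′ ys⊑ys′ s∈ with ∈-++⁻ xs s∈
... | inj₁ s∈xs with xs⊑xs′ s∈xs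
...   | t , t∈ , s≼t = t , ∈-++⁺ˡ t∈ , s≼t
++⁺-⊑ {xs} {xs′} xs⊑xs′ ys⊑ys′ s∈ | inj₂ s∈ys with ys⊑ys′ s∈ys
...   | t , t∈ , s≼t = t , ∈-++⁺ʳ xs′ t∈ , s≼t

map⁺-⊑ : ∀ {f : Path → Path} → (∀ {s t} → s ≼ t → f s ≼ f t) →
         ∀ {xs ys} → xs ⊑ ys → map f xs ⊑ map f ys
map⁺-⊑ {f} f-mono xs⊑ys fs∈ with ∈-map⁻ f fs∈
... | s , s∈xs , refl with xs⊑ys s∈xs
...   | t , t∈ys , s≼t = f t , ∈-map⁺ f t∈ys , f-mono s≼t

⊑-map : ∀ {f : Path → Path} → (∀ s → s ≼ f s) → ∀ {xs} → xs ⊑ map f xs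
⊑-map {f} s≼fs {s = s} s∈xs = f s , ∈-map⁺ f s∈xs , s≼fs s

height : List Path → ℕ
height xs = foldr _⊔_ 0 (map length xs)

length≤height : ∀ {s xs} → s ∈ xs → length s ≤ height xs
length≤height (here refl)         = m≤m⊔n _ _
length≤height {xs = x ∷ _} (there s∈) = ≤-trans (length≤height s∈) (m≤n⊔m (length x) _)

height-mono-⊑ : ∀ {xs ys} → xs ⊑ ys → height xs ≤ height ys
height-mono-⊑ {[]}     _     = z≤n
height-mono-⊑ {_ ∷ xs} xs⊑ys with xs⊑ys (here refl)
... | t , t∈ys , (|s|≤|t| , _) =
  ⊔-lub (≤-trans |s|≤|t| (length≤height t∈ys)) (height-mono-⊑ {xs} (xs⊑ys ∘ there))

Leads : Sign → ℕ → List Path → Set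
Leads σ k xs = ∀ s → s ∈ xs → length s ≡ k → i s ≡ just σ

-- The path dominating a path of maximal length k has length at most k, hence the same
-- length and first symbol.
Leads-⊑ : ∀ {σ k xs ys} → xs ⊑ ys → height ys ≡ k → Leads σ k ys → Leads σ k xs
Leads-⊑ xs⊑ys refl ys-leads s s∈xs |s|≡k with xs⊑ys s∈xs
... | t , t∈ys , (|s|≤|t| , same-i) =
  trans (same-i |s|≡|t|) (ys-leads t t∈ys (trans (sym |s|≡|t|) |s|≡k))
  where
  |s|≡|t| : length s ≡ length t
  |s|≡|t| = ≤-antisym |s|≤|t| (≤-trans (length≤height t∈ys) (≤-reflexive (sym |s|≡k)))

quantSign : Quant → Sign
quantSign ∀q = minus
quantSign ∃q = plus

collapse-∼ : ∀ {q r : Bool} {xs ys : List Path} →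
  (q ≡ true → xs ≡ [] ∷ []) → (r ≡ true → ys ≡ [] ∷ []) →
  (if q ∧ r then [] ∷ [] else xs ++ ys) ∼[ set ] xs ++ ys
collapse-∼ {true}  {true}  xs≡[[]] ys≡[[]] rewrite xs≡[[]] refl | ys≡[[]] refl =
  SetEq.sym (++-idempotent ([] ∷ []))
collapse-∼ {true}  {false} _ _ = SetEq.refl
collapse-∼ {false}         _ _ = SetEq.refl

-- prefixUnless lives in the language-parameterised part of Defs, although it ignores L.
module _ (L : Language) where

  i-prefixUnless : ∀ σ s → i (prefixUnless L σ s) ≡ just σ
  i-prefixUnless plus  []          = refl
  i-prefixUnless plus  (plus ∷ _)  = refl
  i-prefixUnless plus  (minus ∷ _) = refl
  i-prefixUnless minus []          = refl
  i-prefixUnless minus (plus ∷ _)  = refl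
  i-prefixUnless minus (minus ∷ _) = refl

  ≼-prefixUnless : ∀ σ s → s ≼ prefixUnless L σ s
  ≼-prefixUnless σ s with startsWith σ s
  ... | true  = ≼-refl
  ... | false = n≤1+n _ , λ eq → contradiction (sym eq) 1+n≢n

  prefixUnless-mono-≼ : ∀ σ {s t} → s ≼ t → prefixUnless L σ s ≼ prefixUnless L σ t
  prefixUnless-mono-≼ σ {s} {t} (|s|≤|t| , same-i) =
    length-mono , λ _ → trans (i-prefixUnless σ s) (sym (i-prefixUnless σ t))
    where
    length-mono : length (prefixUnless L σ s) ≤ length (prefixUnless L σ t)
    length-mono with startsWith σ s in σs | startsWith σ t in σt
    ... | true  | true  = |s|≤|t|
    ... | false | false = s≤s |s|≤|t|
    ... | true  | false = m≤n⇒m≤1+n |s|≤|t|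
    ... | false | true  = ≤∧≢⇒< |s|≤|t| λ eq →
      contradiction (trans (sym σs) (trans (startsWith-cong σ (same-i eq)) σt)) λ ()

  prefixUnless-⊥ₚ : ∀ σ s → prefixUnless L σ s ⊥ₚ ≡ prefixUnless L (flipS σ) (s ⊥ₚ)
  prefixUnless-⊥ₚ plus  []          = refl
  prefixUnless-⊥ₚ plus  (plus ∷ _)  = refl
  prefixUnless-⊥ₚ plus  (minus ∷ _) = refl
  prefixUnless-⊥ₚ minus []          = refl
  prefixUnless-⊥ₚ minus (plus ∷ _)  = refl
  prefixUnless-⊥ₚ minus (minus ∷ _) = refl

  map-⊥ₚ-prefixUnless : ∀ σ xs →
    map _⊥ₚ (map (prefixUnless L σ) xs) ≡ map (prefixUnless L (flipS σ)) (map _⊥ₚ xs)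
  map-⊥ₚ-prefixUnless σ xs = begin
    map _⊥ₚ (map (prefixUnless L σ) xs)            ≡⟨ map-∘ xs ⟨
    map (_⊥ₚ ∘ prefixUnless L σ) xs                ≡⟨ map-cong (prefixUnless-⊥ₚ σ) xs ⟩
    map (prefixUnless L (flipS σ) ∘ _⊥ₚ) xs        ≡⟨ map-∘ xs ⟩
    map (prefixUnless L (flipS σ)) (map _⊥ₚ xs)    ∎
    where open ≡-Reasoning

  prefix-left-⊑ : ∀ σ xs ys → map (prefixUnless L σ) xs ++ ys ⊑ map (prefixUnless L σ) (xs ++ ys)
  prefix-left-⊑ σ xs ys rewrite map-++ (prefixUnless L σ) xs ys =
    ++⁺-⊑ {map (prefixUnless L σ) xs} ⊑-refl (⊑-map (≼-prefixUnless σ))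

  prefix-right-⊑ : ∀ σ xs ys → xs ++ map (prefixUnless L σ) ys ⊑ map (prefixUnless L σ) (xs ++ ys)
  prefix-right-⊑ σ xs ys rewrite map-++ (prefixUnless L σ) xs ys =
    ++⁺-⊑ {xs} (⊑-map (≼-prefixUnless σ)) ⊑-refl

  Alt-isQF : ∀ φ → isQF L φ ≡ true → Alt L φ ≡ [] ∷ []
  Alt-isQF (atom _ _) _    = refl
  Alt-isQF bot        _    = refl
  Alt-isQF (a ⇒ b)    qf rewrite qf = refl
  Alt-isQF (a ∧ᶠ b)   qf rewrite qf = refl
  Alt-isQF (a ∨ᶠ b)   qf rewrite qf = refl
  Alt-isQF (all _ _)  ()
  Alt-isQF (ex _ _)   ()

  -- Alt without the special case for quantifier-free formulas, so that it is compositional.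
  Alt′ : Formula L → List Path
  Alt′ (atom _ _) = [] ∷ []
  Alt′ bot        = [] ∷ []
  Alt′ (a ⇒ b)    = map _⊥ₚ (Alt′ a) ++ Alt′ b
  Alt′ (a ∧ᶠ b)   = Alt′ a ++ Alt′ b
  Alt′ (a ∨ᶠ b)   = Alt′ a ++ Alt′ b
  Alt′ (all _ a)  = map (prefixUnless L minus) (Alt′ a)
  Alt′ (ex _ a)   = map (prefixUnless L plus) (Alt′ a)

  Alt∼Alt′ : ∀ φ → Alt L φ ∼[ set ] Alt′ φ
  Alt∼Alt′ (atom _ _) = SetEq.refl
  Alt∼Alt′ bot        = SetEq.refl
  Alt∼Alt′ (a ⇒ b)    = SetEq.trans (collapse-∼ (cong (map _⊥ₚ) ∘ Alt-isQF a) (Alt-isQF b))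
                                    (++-cong (map-cong-∼ (λ _ → refl) (Alt∼Alt′ a)) (Alt∼Alt′ b))
  Alt∼Alt′ (a ∧ᶠ b)   = SetEq.trans (collapse-∼ (Alt-isQF a) (Alt-isQF b))
                                    (++-cong (Alt∼Alt′ a) (Alt∼Alt′ b))
  Alt∼Alt′ (a ∨ᶠ b)   = SetEq.trans (collapse-∼ (Alt-isQF a) (Alt-isQF b))
                                    (++-cong (Alt∼Alt′ a) (Alt∼Alt′ b))
  Alt∼Alt′ (all _ a)  = map-cong-∼ (λ _ → refl) (Alt∼Alt′ a)
  Alt∼Alt′ (ex _ a)   = map-cong-∼ (λ _ → refl) (Alt∼Alt′ a)

  Alt′-quant : ∀ Q x φ → Alt′ (quant L Q x φ) ≡ map (prefixUnless L (quantSign Q)) (Alt′ φ)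
  Alt′-quant ∀q _ _ = refl
  Alt′-quant ∃q _ _ = refl

  Alt′-substF : ∀ x y φ → Alt′ (substF L x y φ) ≡ Alt′ φ
  Alt′-substF x y (atom _ _) = refl
  Alt′-substF x y bot        = refl
  Alt′-substF x y (a ⇒ b)    =
    cong₂ (λ as bs → map _⊥ₚ as ++ bs) (Alt′-substF x y a) (Alt′-substF x y b)
  Alt′-substF x y (a ∧ᶠ b)   = cong₂ _++_ (Alt′-substF x y a) (Alt′-substF x y b)
  Alt′-substF x y (a ∨ᶠ b)   = cong₂ _++_ (Alt′-substF x y a) (Alt′-substF x y b)
  Alt′-substF x y (all z a) with z ≟ x
  ... | yes _ = refl
  ... | no  _ = cong (map (prefixUnless L minus)) (Alt′-substF x y a)
  Alt′-substF x y (ex z a) with z ≟ x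
  ... | yes _ = refl
  ... | no  _ = cong (map (prefixUnless L plus)) (Alt′-substF x y a)

  ▷⇒Alt′⊑ : ∀ {φ ψ} → _▷_ L φ ψ → Alt′ φ ⊑ Alt′ ψ
  ▷⇒Alt′⊑ (ex⇒ x ξ δ _) rewrite map-⊥ₚ-prefixUnless plus (Alt′ ξ) =
    prefix-left-⊑ minus (map _⊥ₚ (Alt′ ξ)) (Alt′ δ)
  ▷⇒Alt′⊑ (all⇒ x ξ δ _) rewrite map-⊥ₚ-prefixUnless minus (Alt′ ξ) =
    prefix-left-⊑ plus (map _⊥ₚ (Alt′ ξ)) (Alt′ δ)
  ▷⇒Alt′⊑ (⇒Q Q x ξ δ _) rewrite Alt′-quant Q x ξ | Alt′-quant Q x (δ ⇒ ξ) =
    prefix-right-⊑ (quantSign Q) (map _⊥ₚ (Alt′ δ)) (Alt′ ξ)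
  ▷⇒Alt′⊑ (Q∧ Q x ξ δ _) rewrite Alt′-quant Q x ξ | Alt′-quant Q x (ξ ∧ᶠ δ) =
    prefix-left-⊑ (quantSign Q) (Alt′ ξ) (Alt′ δ)
  ▷⇒Alt′⊑ (∧Q Q x ξ δ _) rewrite Alt′-quant Q x ξ | Alt′-quant Q x (δ ∧ᶠ ξ) =
    prefix-right-⊑ (quantSign Q) (Alt′ δ) (Alt′ ξ)
  ▷⇒Alt′⊑ (Q∨ Q x ξ δ _) rewrite Alt′-quant Q x ξ | Alt′-quant Q x (ξ ∨ᶠ δ) =
    prefix-left-⊑ (quantSign Q) (Alt′ ξ) (Alt′ δ)
  ▷⇒Alt′⊑ (∨Q Q x ξ δ _) rewrite Alt′-quant Q x ξ | Alt′-quant Q x (δ ∨ᶠ ξ) =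
    prefix-right-⊑ (quantSign Q) (Alt′ δ) (Alt′ ξ)
  ▷⇒Alt′⊑ (rename Q x y ξ _)
    rewrite Alt′-quant Q x ξ | Alt′-quant Q y (substF L x y ξ) | Alt′-substF x y ξ = ⊑-refl

  Replace⇒Alt′⊑ : ∀ {φ ψ} → Replace L φ ψ → Alt′ φ ⊑ Alt′ ψ
  Replace⇒Alt′⊑ (here φ▷ψ) = ▷⇒Alt′⊑ φ▷ψ
  Replace⇒Alt′⊑ (⇒l {b = b} r) = ++⁺-⊑ {ys = Alt′ b} (map⁺-⊑ ⊥ₚ-mono-≼ (Replace⇒Alt′⊑ r)) ⊑-refl
  Replace⇒Alt′⊑ (⇒r {a} r)     = ++⁺-⊑ {map _⊥ₚ (Alt′ a)} ⊑-refl (Replace⇒Alt′⊑ r)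
  Replace⇒Alt′⊑ (∧l {b = b} r) = ++⁺-⊑ {ys = Alt′ b} (Replace⇒Alt′⊑ r) ⊑-refl
  Replace⇒Alt′⊑ (∧r {a} r)     = ++⁺-⊑ {Alt′ a} ⊑-refl (Replace⇒Alt′⊑ r)
  Replace⇒Alt′⊑ (∨l {b = b} r) = ++⁺-⊑ {ys = Alt′ b} (Replace⇒Alt′⊑ r) ⊑-refl
  Replace⇒Alt′⊑ (∨r {a} r)     = ++⁺-⊑ {Alt′ a} ⊑-refl (Replace⇒Alt′⊑ r)
  Replace⇒Alt′⊑ (allR r)       = map⁺-⊑ (prefixUnless-mono-≼ minus) (Replace⇒Alt′⊑ r)
  Replace⇒Alt′⊑ (exR r)        = map⁺-⊑ (prefixUnless-mono-≼ plus) (Replace⇒Alt′⊑ r)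

  Below : ℕ → Formula L → Set
  Below k φ = Σ ℕ λ j → j < k × F L j φ

  module _ {φ ψ : Formula L} (Altφ⊑Altψ : Alt L φ ⊑ Alt L ψ) where

    deg-mono : deg L φ ≤ deg L ψ
    deg-mono = height-mono-⊑ {Alt L φ} Altφ⊑Altψ

    F-⊑ : ∀ {k} → F L k ψ → F L k φ ⊎ Below k φ
    F-⊑ refl with m≤n⇒m<n∨m≡n deg-mono
    ... | inj₁ lower = inj₂ (deg L φ , lower , refl)
    ... | inj₂ same  = inj₁ same

    Below-⊑ : ∀ {k} → Below k ψ → Below k φ
    Below-⊑ (j , j<k , refl) = deg L φ , ≤-<-trans deg-mono j<k , refl

    Leading-⊑ : ∀ {σ k} → F L k ψ × Leads σ k (Alt L ψ) → F L k φ × Leads σ k (Alt L φ) ⊎ Below k φ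
    Leading-⊑ (ψ∈Fₖ , ψ-leads) with F-⊑ ψ∈Fₖ
    ... | inj₁ φ∈Fₖ = inj₁ (φ∈Fₖ , Leads-⊑ {xs = Alt L φ} Altφ⊑Altψ ψ∈Fₖ ψ-leads)
    ... | inj₂ lower = inj₂ lower

    E-⊑ : ∀ k → E L k ψ → E⁺ L k φ
    E-⊑ zero    = F-⊑
    E-⊑ (suc k) = Leading-⊑

    U-⊑ : ∀ k → U L k ψ → U⁺ L k φ
    U-⊑ zero    = F-⊑
    U-⊑ (suc k) = Leading-⊑

    E⁺-⊑ : ∀ k → E⁺ L k ψ → E⁺ L k φ
    E⁺-⊑ k = [ E-⊑ k , inj₂ ∘ Below-⊑ ]

    U⁺-⊑ : ∀ k → U⁺ L k ψ → U⁺ L k φ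
    U⁺-⊑ k = [ U-⊑ k , inj₂ ∘ Below-⊑ ]

  Replace⇒Alt⊑ : ∀ {φ ψ} → Replace L φ ψ → Alt L φ ⊑ Alt L ψ
  Replace⇒Alt⊑ {φ} {ψ} r = ⊑-respects-∼ (Alt∼Alt′ φ) (Alt∼Alt′ ψ) (Replace⇒Alt′⊑ r)

lemma4p5 : (L : Language) (k : ℕ) (φ ψ : Formula L) →
    Replace L φ ψ →
    (E⁺ L k ψ → E⁺ L k φ) × (U⁺ L k ψ → U⁺ L k φ)
lemma4p5 L k φ ψ r = E⁺-⊑ L Altφ⊑Altψ k , U⁺-⊑ L Altφ⊑Altψ k
  where
  Altφ⊑Altψ : Alt L φ ⊑ Alt L ψ
  Altφ⊑Altψ = Replace⇒Alt⊑ L r
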